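{- Every lifted-graphic matroid is quasi-graphic.
   Context: For a graph $G$ and a vertex $v$, $\mathrm{loops}_G(v)$ denotes the set of loop-edges of $G$ at $v$. Graphs are finite and may have loops and parallel edges. For a set $X$ of edges, $G[X]$ is the subgraph of $G$ with edge-set $X$ and no isolated vertices. A graph $G$ is a framework for a matroid $M$ if (1) $E(G)=E(M)$; (2) $r_M(E(H))\le |V(H)|$ for each component $H$ of $G$; (3) for each vertex $v$ of $G$, $\mathrm{cl}_M(E(G-v))\subseteq E(G-v)\cup \mathrm{loops}_G(v)$; and (4) for each circuit $C$ of $M$, the subgraph $G[C]$ has at most two components. A matroid is quasi-graphic if it has a framework. A matroid $M$ is lifted-graphic if there is a matroid $M'$ and an element $e\in E(M')$ such that $M'\setminus e=M$ and $M'/e$ is graphic. -}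

module Defs where

open import Data.Nat using (ℕ; zero; suc; _+_; _∸_; _≤_; _<_)
open import Data.Bool using (Bool; true; false; if_then_else_)
open import Data.Fin using (Fin; zero; suc; _≟_)
open import Data.Fin.Subset using (Subset; inside; outside; _∈_; _∉_; _⊆_; _⊂_; _∪_; _∩_; ∣_∣; ⁅_⁆; ⊤; Nonempty)
open import Data.Vec using (_∷_; lookup; tabulate)
open import Data.List using (map; allFin)
open import Data.Nat.ListAction using (sum)
open import Data.Product using (Σ; ∃; ∃-syntax; _×_; _,_)
open import Data.Sum using (_⊎_)
open import Relation.Nullary using (¬_; Dec; yes; no)
open import Relation.Nullary.Decidable using (⌊_⌋)
open import Relation.Binary.PropositionalEquality using (_≡_)
open import Relation.Binary.Construct.Closure.ReflexiveTransitive using (Star)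

record Matroid (n : ℕ) : Set where
  field
    rank      : Subset n → ℕ
    bounded   : ∀ X → rank X ≤ ∣ X ∣
    monotone  : ∀ X Y → X ⊆ Y → rank X ≤ rank Y
    submod    : ∀ X Y → rank (X ∪ Y) + rank (X ∩ Y) ≤ rank X + rank Y

open Matroid public

Dependent : ∀ {n} → (Subset n → ℕ) → Subset n → Set
Dependent r X = r X < ∣ X ∣

IsCircuit : ∀ {n} → (Subset n → ℕ) → Subset n → Set
IsCircuit r C = Dependent r C × (∀ D → D ⊂ C → ¬ Dependent r D)

_∈cl[_]_ : ∀ {n} → Fin n → (Subset n → ℕ) → Subset n → Set
f ∈cl[ r ] X = r (X ∪ ⁅ f ⁆) ≡ r X

-- Graphs with vertex set Fin m and edge set Fin n (loops and parallel
-- edges allowed); edge e has ends src e and tgt e (loop iff equal).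

record Graph (m n : ℕ) : Set where
  field
    src tgt : Fin n → Fin m

open Graph public

module _ {m n : ℕ} (G : Graph m n) where

  Adj : Subset n → Fin m → Fin m → Set
  Adj X u v = ∃[ e ] (e ∈ X × ((src G e ≡ u × tgt G e ≡ v) ⊎ (src G e ≡ v × tgt G e ≡ u)))

  Conn : Subset n → Fin m → Fin m → Set
  Conn X = Star (Adj X)

  VertexOf : Subset n → Fin m → Set
  VertexOf X v = ∃[ e ] (e ∈ X × (src G e ≡ v ⊎ tgt G e ≡ v))

  -- degree of v in G[X] (a loop counts twice)
  ind : Fin m → Fin m → ℕ
  ind a b = if ⌊ a ≟ b ⌋ then 1 else 0

  degree : Subset n → Fin m → ℕ
  degree X v = sum (map (λ e → if lookup X e then ind (src G e) v + ind (tgt G e) v else 0) (allFin n))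

  IsCycle : Subset n → Set
  IsCycle X = Nonempty X
            × (∀ e f → e ∈ X → f ∈ X → Conn X (src G e) (src G f))
            × (∀ v → VertexOf X v → degree X v ≡ 2)

  edgesAvoiding : Fin m → Subset n
  edgesAvoiding v = tabulate (λ e → if ⌊ src G e ≟ v ⌋ then false
                                    else if ⌊ tgt G e ≟ v ⌋ then false else true)

  IsFramework : (Subset n → ℕ) → Set
  IsFramework r =
      -- (2) each component H (the one containing v): r(E(H)) ≤ |V(H)|
      (∀ v (S : Subset n) (W : Subset m) →
         (∀ e → (e ∈ S → Conn ⊤ v (src G e)) × (Conn ⊤ v (src G e) → e ∈ S)) →
         (∀ u → (u ∈ W → Conn ⊤ v u) × (Conn ⊤ v u → u ∈ W)) →
         r S ≤ ∣ W ∣)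
    ×
      (∀ v f → f ∈cl[ r ] (edgesAvoiding v) →
         f ∈ edgesAvoiding v ⊎ (src G f ≡ v × tgt G f ≡ v))
    × -- (4) for each circuit C, G[C] has at most two components
      (∀ C → IsCircuit r C →
         ∃[ a ] ∃[ b ] (∀ v → VertexOf C v → Conn C a v ⊎ Conn C b v))

-- M quasi-graphic: it has a framework (condition (1) E(G)=E(M) is built in)
QuasiGraphic : ∀ {n} → Matroid n → Set
QuasiGraphic {n} M = ∃[ m ] Σ (Graph m n) (λ G → IsFramework G (rank M))

Graphic : ∀ {n} → (Subset n → ℕ) → Set
Graphic {n} r = ∃[ m ] Σ (Graph m n) (λ G →
  ∀ C → (IsCircuit r C → IsCycle G C) × (IsCycle G C → IsCircuit r C))

-- Lifted-graphic: there is M' on E(M) ⊎ {e} (encoded as Fin (suc n) with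
-- e = zero) with M' \ e = M and M' / e graphic.
LiftedGraphic : ∀ {n} → Matroid n → Set
LiftedGraphic {n} M = Σ (Matroid (suc n)) (λ M' →
    (∀ X → rank M' (outside ∷ X) ≡ rank M X)
  × Graphic (λ X → rank M' (inside ∷ X) ∸ rank M' ⁅ zero ⁆))

-- Let M′ witness that M is lifted-graphic and put N = M′ / e, graphic with
-- graph G.  Then M = M′ \ e is an elementary lift of N: closures in M lie
-- inside closures in N, and r_M ≤ r_N + 1.  The graph G is a framework for M.
-- (2) For the edges S of a component with vertex set W, r_N(S) < |W| as N is
-- graphic (a forest has fewer edges than vertices); hence r_M(S) ≤ |W|.
-- (3) If a link f at v lay in cl_M(E(G - v)), it would lie in cl_N(E(G - v)),
-- and its fundamental N-circuit would be a cycle meeting v in f alone.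
-- (4) Each vertex x of G[C], for an M-circuit C, is joined in G[C] to an
-- N-circuit inside C (the fundamental N-circuit of an edge at x).  Three
-- components of G[C] would give three disjoint N-circuits in C, so
-- r_N(C) ≤ |C| - 3, while |C| - 1 = r_M(C) ≤ r_N(C) + 1.

module Submission where

open import Defs
import Algebra.Properties.CommutativeSemigroup
open import Data.Nat using (ℕ; _≟_; zero; suc; _+_; _∸_; _≤_; _<_; z≤n; s≤s; s≤s⁻¹; z<s; _<?_)
open import Data.Nat.Properties hiding (_≟_)
open import Data.Bool using (true; false; if_then_else_)
open import Data.Fin using (Fin; zero; suc) renaming (_≟_ to _≟ᶠ_)
open import Data.Fin.Properties using (any?)
open import Data.Fin.Subset
open import Data.Fin.Subset.Properties
open import Data.Fin.Subset.Induction using (⊂-wellFounded; ⊃-wellFounded)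
open import Data.List using (map; allFin)
import Data.List as List
open import Data.List.Properties using (map-tabulate)
open import Data.Nat.ListAction using (sum)
open import Data.Vec using ([]; _∷_; lookup; tabulate; here; there)
open import Data.Vec.Properties using (lookup∘tabulate; []=⇒lookup; lookup⇒[]=)
open import Data.Product using (∃; ∃-syntax; _×_; _,_; proj₁; proj₂)
open import Data.Sum using (_⊎_; inj₁; inj₂)
open import Data.Empty using (⊥-elim)
open import Function using (_∘_)
open import Induction.WellFounded using (Acc; acc)
open import Relation.Binary.Construct.Closure.ReflexiveTransitive using (Star; ε; _◅_; _◅◅_; reverse)
import Relation.Binary.Construct.Closure.ReflexiveTransitive as Star
open import Relation.Binary.PropositionalEquality
  using (_≡_; _≢_; refl; sym; trans; cong; cong₂; subst; module ≡-Reasoning)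
open import Relation.Nullary using (¬_; Dec; yes; no)
open import Relation.Nullary.Decidable
  using (⌊_⌋; _×-dec_; _⊎-dec_; ¬?; isYes≗does; decidable-stable; dec-true; dec-false)

open Algebra.Properties.CommutativeSemigroup +-commutativeSemigroup
  using (x∙yz≈y∙xz; xy∙z≈y∙xz; interchange)

variable
  m n : ℕ

x∈q⇒x∉p─q : ∀ {p q : Subset n} {x} → x ∈ q → x ∉ p ─ q
x∈q⇒x∉p─q {p = _ ∷ p} {inside ∷ q} here        ()
x∈q⇒x∉p─q {p = _ ∷ p} {_ ∷ q}      (there x∈q) (there x∈p─q) = x∈q⇒x∉p─q x∈q x∈p─q

x∉p-x : ∀ (p : Subset n) x → x ∉ p - x
x∉p-x p x = x∈q⇒x∉p─q (x∈⁅x⁆ x)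

∪-⊆ : ∀ {p q s : Subset n} → p ⊆ s → q ⊆ s → p ∪ q ⊆ s
∪-⊆ {p = p} {q} p⊆s q⊆s x∈p∪q with x∈p∪q⁻ p q x∈p∪q
... | inj₁ x∈p = p⊆s x∈p
... | inj₂ x∈q = q⊆s x∈q

p⊆q⇒p∪[q─p]≡q : ∀ {p q : Subset n} → p ⊆ q → p ∪ (q ─ p) ≡ q
p⊆q⇒p∪[q─p]≡q {p = []}          {[]}    p⊆q = refl
p⊆q⇒p∪[q─p]≡q {p = inside ∷ p}  {_ ∷ q} p⊆q with p⊆q here
... | here = cong (inside ∷_) (p⊆q⇒p∪[q─p]≡q (drop-∷-⊆ p⊆q))
p⊆q⇒p∪[q─p]≡q {p = outside ∷ p} {s ∷ q} p⊆q = cong (s ∷_) (p⊆q⇒p∪[q─p]≡q (drop-∷-⊆ p⊆q))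

x∈p⇒⁅x⁆⊆p : ∀ {p : Subset n} {x} → x ∈ p → ⁅ x ⁆ ⊆ p
x∈p⇒⁅x⁆⊆p {p = p} {x} x∈p y∈⁅x⁆ = subst (_∈ p) (sym (x∈⁅y⁆⇒x≡y x y∈⁅x⁆)) x∈p

x∈p⇒⁅x⁆∪[p-x]≡p : ∀ {p : Subset n} {x} → x ∈ p → ⁅ x ⁆ ∪ (p - x) ≡ p
x∈p⇒⁅x⁆∪[p-x]≡p x∈p = p⊆q⇒p∪[q─p]≡q (x∈p⇒⁅x⁆⊆p x∈p)

x∈p⇒[p-x]∪⁅x⁆≡p : ∀ {p : Subset n} {x} → x ∈ p → (p - x) ∪ ⁅ x ⁆ ≡ p
x∈p⇒[p-x]∪⁅x⁆≡p {p = p} {x} x∈p = trans (∪-comm (p - x) ⁅ x ⁆) (x∈p⇒⁅x⁆∪[p-x]≡p x∈p)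

Disjoint : Subset n → Subset n → Set
Disjoint p q = ∀ {x} → x ∈ p → x ∉ q

∣p∪q∣≡∣p∣+∣q∣ : ∀ {p q : Subset n} → Disjoint p q → ∣ p ∪ q ∣ ≡ ∣ p ∣ + ∣ q ∣
∣p∪q∣≡∣p∣+∣q∣ {p = []}          {[]}          disj = refl
∣p∪q∣≡∣p∣+∣q∣ {p = inside ∷ p}  {inside ∷ q}  disj = ⊥-elim (disj here here)
∣p∪q∣≡∣p∣+∣q∣ {p = inside ∷ p}  {outside ∷ q} disj =
  cong suc (∣p∪q∣≡∣p∣+∣q∣ (λ x∈p x∈q → disj (there x∈p) (there x∈q)))
∣p∪q∣≡∣p∣+∣q∣ {p = outside ∷ p} {inside ∷ q}  disj =
  trans (cong suc (∣p∪q∣≡∣p∣+∣q∣ (λ x∈p x∈q → disj (there x∈p) (there x∈q)))) (sym (+-suc ∣ p ∣ ∣ q ∣))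
∣p∪q∣≡∣p∣+∣q∣ {p = outside ∷ p} {outside ∷ q} disj =
  ∣p∪q∣≡∣p∣+∣q∣ (λ x∈p x∈q → disj (there x∈p) (there x∈q))

∣⁅x⁆∪p∣≡1+∣p∣ : ∀ {p : Subset n} {x} → x ∉ p → ∣ ⁅ x ⁆ ∪ p ∣ ≡ suc ∣ p ∣
∣⁅x⁆∪p∣≡1+∣p∣ {p = p} {x} x∉p =
  trans (∣p∪q∣≡∣p∣+∣q∣ (λ y∈⁅x⁆ → subst (_∉ p) (sym (x∈⁅y⁆⇒x≡y x y∈⁅x⁆)) x∉p))
        (cong (_+ ∣ p ∣) (∣⁅x⁆∣≡1 x))

∣p∣≡1+∣p-x∣ : ∀ {p : Subset n} {x} → x ∈ p → ∣ p ∣ ≡ suc ∣ p - x ∣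
∣p∣≡1+∣p-x∣ {p = p} {x} x∈p = begin
  ∣ p ∣               ≡⟨ cong ∣_∣ (sym (x∈p⇒⁅x⁆∪[p-x]≡p x∈p)) ⟩
  ∣ ⁅ x ⁆ ∪ (p - x) ∣ ≡⟨ ∣⁅x⁆∪p∣≡1+∣p∣ (x∉p-x p x) ⟩
  suc ∣ p - x ∣       ∎
  where open ≡-Reasoning

∣p∣≡0⊎Nonempty : ∀ (p : Subset n) → ∣ p ∣ ≡ 0 ⊎ Nonempty p
∣p∣≡0⊎Nonempty {n} p with nonempty? p
... | yes ne = inj₂ ne
... | no ¬ne = inj₁ (trans (cong ∣_∣ (Empty-unique ¬ne)) (∣⊥∣≡0 n))

x∈p⇒∣p∣>0 : ∀ {p : Subset n} {x} → x ∈ p → 0 < ∣ p ∣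
x∈p⇒∣p∣>0 x∈p = ≤-<-trans z≤n (x∈p⇒∣p-x∣<∣p∣ x∈p)

sumOver : Subset n → (Fin n → ℕ) → ℕ
sumOver []            h = 0
sumOver (inside ∷ X)  h = h zero + sumOver X (h ∘ suc)
sumOver (outside ∷ X) h = sumOver X (h ∘ suc)

sum-allFin-if≡sumOver : ∀ (X : Subset n) h →
  sum (map (λ e → if lookup X e then h e else 0) (allFin n)) ≡ sumOver X h
sum-allFin-if≡sumOver {n} X h =
  trans (cong sum (map-tabulate {n = n} (λ e → e) (λ e → if lookup X e then h e else 0)))
        (sum-tabulate X h)
  where
  sum-tabulate : ∀ {n} (X : Subset n) h →
    sum (List.tabulate (λ e → if lookup X e then h e else 0)) ≡ sumOver X h
  sum-tabulate []            h = refl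
  sum-tabulate (inside ∷ X)  h = cong (h zero +_) (sum-tabulate X (h ∘ suc))
  sum-tabulate (outside ∷ X) h = sum-tabulate X (h ∘ suc)

sumOver-zero : ∀ (X : Subset n) {h} → (∀ {x} → x ∈ X → h x ≡ 0) → sumOver X h ≡ 0
sumOver-zero []            z = refl
sumOver-zero (inside ∷ X)  z = cong₂ _+_ (z here) (sumOver-zero X (z ∘ there))
sumOver-zero (outside ∷ X) z = sumOver-zero X (z ∘ there)

term≤sumOver : ∀ {X : Subset n} h {x} → x ∈ X → h x ≤ sumOver X h
term≤sumOver {X = inside ∷ X}  h here      = m≤m+n _ _
term≤sumOver {X = inside ∷ X}  h (there p) = ≤-trans (term≤sumOver (h ∘ suc) p) (m≤n+m _ _)
term≤sumOver {X = outside ∷ X} h (there p) = term≤sumOver (h ∘ suc) p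

sumOver-positive : ∀ (X : Subset n) h → 0 < sumOver X h → ∃[ x ] (x ∈ X × 0 < h x)
sumOver-positive (inside ∷ X) h pos with h zero in eq
... | suc _ = zero , here , subst (0 <_) (sym eq) z<s
... | zero  with sumOver-positive X (h ∘ suc) pos
...   | x , x∈X , hx = suc x , there x∈X , hx
sumOver-positive (outside ∷ X) h pos with sumOver-positive X (h ∘ suc) pos
... | x , x∈X , hx = suc x , there x∈X , hx

sumOver-insert : ∀ (X : Subset n) h {x} → x ∉ X → sumOver (⁅ x ⁆ ∪ X) h ≡ h x + sumOver X h
sumOver-insert (inside ∷ X)  h {zero}  x∉X = ⊥-elim (x∉X here)
sumOver-insert (outside ∷ X) h {zero}  x∉X = cong (λ Y → h zero + sumOver Y (h ∘ suc)) (∪-identityˡ X)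
sumOver-insert (inside ∷ X)  h {suc x} x∉X = begin
  h zero + sumOver (⁅ x ⁆ ∪ X) (h ∘ suc)   ≡⟨ cong (h zero +_) (sumOver-insert X (h ∘ suc) (x∉X ∘ there)) ⟩
  h zero + (h (suc x) + sumOver X (h ∘ suc)) ≡⟨ x∙yz≈y∙xz (h zero) (h (suc x)) (sumOver X (h ∘ suc)) ⟩
  h (suc x) + (h zero + sumOver X (h ∘ suc)) ∎
  where open ≡-Reasoning
sumOver-insert (outside ∷ X) h {suc x} x∉X = sumOver-insert X (h ∘ suc) (x∉X ∘ there)

sumOver-remove : ∀ (X : Subset n) h {x} → x ∈ X → sumOver X h ≡ h x + sumOver (X - x) h
sumOver-remove X h {x} x∈X = begin
  sumOver X h                   ≡⟨ cong (λ Y → sumOver Y h) (sym (x∈p⇒⁅x⁆∪[p-x]≡p x∈X)) ⟩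
  sumOver (⁅ x ⁆ ∪ (X - x)) h   ≡⟨ sumOver-insert (X - x) h (x∉p-x X x) ⟩
  h x + sumOver (X - x) h       ∎
  where open ≡-Reasoning

sumOver-single : ∀ (X : Subset n) h {x} → x ∈ X → (∀ {y} → y ∈ X → y ≢ x → h y ≡ 0) →
                 sumOver X h ≡ h x
sumOver-single X h {x} x∈X others = begin
  sumOver X h             ≡⟨ sumOver-remove X h x∈X ⟩
  h x + sumOver (X - x) h ≡⟨ cong (h x +_) (sumOver-zero (X - x) λ y∈X-x →
                               others (p─q⊆p X ⁅ x ⁆ y∈X-x) (λ { refl → x∉p-x X x y∈X-x })) ⟩
  h x + 0                 ≡⟨ +-identityʳ (h x) ⟩
  h x                     ∎
  where open ≡-Reasoning

two-terms≤sumOver : ∀ (X : Subset n) h {x y} → x ∈ X → y ∈ X → y ≢ x → h x + h y ≤ sumOver X h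
two-terms≤sumOver X h {x} {y} x∈X y∈X y≢x = begin
  h x + h y               ≤⟨ +-monoʳ-≤ (h x) (term≤sumOver h (x∈p∧x≢y⇒x∈p-y y∈X y≢x)) ⟩
  h x + sumOver (X - x) h ≡⟨ sym (sumOver-remove X h x∈X) ⟩
  sumOver X h             ∎
  where open ≤-Reasoning

module MatroidProperties {n : ℕ} (M : Matroid n) where

  r : Subset n → ℕ
  r = rank M

  rank-subadditive : ∀ A B → r (A ∪ B) ≤ r A + r B
  rank-subadditive A B = ≤-trans (m≤m+n _ _) (submod M A B)

  dependent? : ∀ X → Dec (Dependent r X)
  dependent? X = r X <? ∣ X ∣

  dependent⇒nonempty : ∀ {X} → Dependent r X → Nonempty X
  dependent⇒nonempty {X} dep with ∣p∣≡0⊎Nonempty X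
  ... | inj₁ ∣X∣≡0 = ⊥-elim (1+n≰n (≤-trans (subst (suc (r X) ≤_) ∣X∣≡0 dep) z≤n))
  ... | inj₂ ne    = ne

  -- Nullity ∣ X ∣ ∸ r X at least k, stated without truncated subtraction;
  -- Dependent r X is NullityAtLeast 1 X by definition.
  NullityAtLeast : ℕ → Subset n → Set
  NullityAtLeast k X = k + r X ≤ ∣ X ∣

  nullity-mono : ∀ {k Y X} → Y ⊆ X → NullityAtLeast k Y → NullityAtLeast k X
  nullity-mono {k} {Y} {X} Y⊆X nY = begin
    k + r X                ≡⟨ cong (λ Z → k + r Z) (sym (p⊆q⇒p∪[q─p]≡q Y⊆X)) ⟩
    k + r (Y ∪ (X ─ Y))    ≤⟨ +-monoʳ-≤ k (rank-subadditive Y (X ─ Y)) ⟩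
    k + (r Y + r (X ─ Y))  ≡⟨ sym (+-assoc k (r Y) (r (X ─ Y))) ⟩
    k + r Y + r (X ─ Y)    ≤⟨ +-mono-≤ nY (bounded M (X ─ Y)) ⟩
    ∣ Y ∣ + ∣ X ─ Y ∣      ≡⟨ sym (∣p∪q∣≡∣p∣+∣q∣ {p = Y} {X ─ Y} x∈q⇒x∉p─q) ⟩
    ∣ Y ∪ (X ─ Y) ∣        ≡⟨ cong ∣_∣ (p⊆q⇒p∪[q─p]≡q Y⊆X) ⟩
    ∣ X ∣                  ∎
    where open ≤-Reasoning

  nullity-∪ : ∀ {i j A B} → Disjoint A B →
              NullityAtLeast i A → NullityAtLeast j B → NullityAtLeast (i + j) (A ∪ B)
  nullity-∪ {i} {j} {A} {B} disj nA nB = begin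
    i + j + r (A ∪ B)      ≤⟨ +-monoʳ-≤ (i + j) (rank-subadditive A B) ⟩
    i + j + (r A + r B)    ≡⟨ interchange i j (r A) (r B) ⟩
    i + r A + (j + r B)    ≤⟨ +-mono-≤ nA nB ⟩
    ∣ A ∣ + ∣ B ∣          ≡⟨ sym (∣p∪q∣≡∣p∣+∣q∣ disj) ⟩
    ∣ A ∪ B ∣              ∎
    where open ≤-Reasoning

  independent-⊆ : ∀ {Y X} → Y ⊆ X → ¬ Dependent r X → ¬ Dependent r Y
  independent-⊆ Y⊆X indep depY = indep (nullity-mono Y⊆X depY)

  dependent⇒∃circuit : ∀ {D} → Dependent r D → ∃[ C ] (C ⊆ D × IsCircuit r C)
  dependent⇒∃circuit {D} = go D (⊂-wellFounded D)
    where
    go : ∀ D → Acc _⊂_ D → Dependent r D → ∃[ C ] (C ⊆ D × IsCircuit r C)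
    go D (acc rec) dep with any? (λ x → (x ∈? D) ×-dec dependent? (D - x))
    ... | yes (x , x∈D , dep-x) with go (D - x) (rec (x∈p⇒p-x⊂p x∈D)) dep-x
    ...   | C , C⊆D-x , circ = C , (λ y∈C → p─q⊆p D ⁅ x ⁆ (C⊆D-x y∈C)) , circ
    go D (acc rec) dep | no ¬∃ = D , (λ x∈D → x∈D) , dep , minimal
      where
      minimal : ∀ E → E ⊂ D → ¬ Dependent r E
      minimal E (E⊆D , x , x∈D , x∉E) depE = ¬∃ (x , x∈D , nullity-mono E⊆D-x depE)
        where
        E⊆D-x : E ⊆ D - x
        E⊆D-x y∈E = x∈p∧x≢y⇒x∈p-y (E⊆D y∈E) (λ { refl → x∉E y∈E })

  circuit-rank : ∀ {C x} → IsCircuit r C → x ∈ C → r (C - x) ≡ ∣ C - x ∣ × r C ≡ ∣ C - x ∣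
  circuit-rank {C} {x} (dep , minimal) x∈C =
    ≤-antisym (≤-trans r[C-x]≤r[C] r[C]≤∣C-x∣) ∣C-x∣≤r[C-x] ,
    ≤-antisym r[C]≤∣C-x∣ (≤-trans ∣C-x∣≤r[C-x] r[C-x]≤r[C])
    where
    ∣C-x∣≤r[C-x] : ∣ C - x ∣ ≤ r (C - x)
    ∣C-x∣≤r[C-x] = ≮⇒≥ (minimal (C - x) (x∈p⇒p-x⊂p x∈C))
    r[C-x]≤r[C] : r (C - x) ≤ r C
    r[C-x]≤r[C] = monotone M _ _ (p─q⊆p C ⁅ x ⁆)
    r[C]≤∣C-x∣ : r C ≤ ∣ C - x ∣
    r[C]≤∣C-x∣ = s≤s⁻¹ (subst (suc (r C) ≤_) (∣p∣≡1+∣p-x∣ x∈C) dep)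

  circuit-size : ∀ {C x} → IsCircuit r C → x ∈ C → ∣ C ∣ ≡ suc (r C)
  circuit-size circ x∈C = trans (∣p∣≡1+∣p-x∣ x∈C) (cong suc (sym (proj₂ (circuit-rank circ x∈C))))

  circuit-∈cl : ∀ {C x} → IsCircuit r C → x ∈ C → x ∈cl[ r ] (C - x)
  circuit-∈cl {C} {x} circ x∈C =
    trans (cong r (x∈p⇒[p-x]∪⁅x⁆≡p x∈C)) (trans (proj₂ rk) (sym (proj₁ rk)))
    where rk = circuit-rank circ x∈C

  -- Submodularity in the form "what does not raise the rank of A does not
  -- raise the rank of any A ∪ C".
  ⊆-same-rank-∪ : ∀ {A B} C → A ⊆ B → r B ≡ r A → r (B ∪ C) ≤ r (A ∪ C)
  ⊆-same-rank-∪ {A} {B} C A⊆B rB≡rA = +-cancelʳ-≤ (r A) _ _ (begin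
    r (B ∪ C) + r A                        ≤⟨ +-mono-≤ (monotone M _ _ B∪C⊆) (monotone M _ _ A⊆) ⟩
    r (B ∪ (A ∪ C)) + r (B ∩ (A ∪ C))      ≤⟨ submod M B (A ∪ C) ⟩
    r B + r (A ∪ C)                        ≡⟨ cong (_+ r (A ∪ C)) rB≡rA ⟩
    r A + r (A ∪ C)                        ≡⟨ +-comm (r A) _ ⟩
    r (A ∪ C) + r A                        ∎)
    where
    open ≤-Reasoning
    B∪C⊆ : B ∪ C ⊆ B ∪ (A ∪ C)
    B∪C⊆ = ∪-⊆ (p⊆p∪q (A ∪ C)) (λ x∈C → q⊆p∪q B (A ∪ C) (q⊆p∪q A C x∈C))
    A⊆ : A ⊆ B ∩ (A ∪ C)
    A⊆ x∈A = x∈p∩q⁺ (A⊆B x∈A , p⊆p∪q C x∈A)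

  cl-mono : ∀ {A B x} → A ⊆ B → x ∈cl[ r ] A → x ∈cl[ r ] B
  cl-mono {A} {B} {x} A⊆B x∈clA = ≤-antisym (begin
    r (B ∪ ⁅ x ⁆)          ≤⟨ monotone M _ _ B∪x⊆ ⟩
    r ((A ∪ ⁅ x ⁆) ∪ B)    ≤⟨ ⊆-same-rank-∪ B (p⊆p∪q ⁅ x ⁆) x∈clA ⟩
    r (A ∪ B)              ≤⟨ monotone M _ _ (∪-⊆ A⊆B (λ y∈B → y∈B)) ⟩
    r B                    ∎) (monotone M _ _ (p⊆p∪q ⁅ x ⁆))
    where
    open ≤-Reasoning
    B∪x⊆ : B ∪ ⁅ x ⁆ ⊆ (A ∪ ⁅ x ⁆) ∪ B
    B∪x⊆ = ∪-⊆ (q⊆p∪q (A ∪ ⁅ x ⁆) B) (λ y∈⁅x⁆ → p⊆p∪q B (q⊆p∪q A ⁅ x ⁆ y∈⁅x⁆))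

  dependent⇒redundant : ∀ {X} → Dependent r X → ∃[ x ] (x ∈ X × r (X - x) ≡ r X)
  dependent⇒redundant {X} dep with dependent⇒∃circuit dep
  ... | C , C⊆X , circ with dependent⇒nonempty (proj₁ circ)
  ...   | x , x∈C = x , C⊆X x∈C ,
                    sym (trans (cong r (sym (x∈p⇒[p-x]∪⁅x⁆≡p (C⊆X x∈C))))
                               (cl-mono C-x⊆X-x (circuit-∈cl circ x∈C)))
    where
    C-x⊆X-x : C - x ⊆ X - x
    C-x⊆X-x y∈C-x = x∈p∧x≢y⇒x∈p-y (C⊆X (p─q⊆p C ⁅ x ⁆ y∈C-x)) (λ { refl → x∉p-x C x y∈C-x })

  ∃-basis : ∀ X → ∃[ B ] (B ⊆ X × ¬ Dependent r B × r B ≡ r X)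
  ∃-basis X = go X (⊂-wellFounded X)
    where
    go : ∀ X → Acc _⊂_ X → ∃[ B ] (B ⊆ X × ¬ Dependent r B × r B ≡ r X)
    go X (acc rec) with dependent? X
    ... | no indep = X , (λ x∈X → x∈X) , indep , refl
    ... | yes dep  = shrink (dependent⇒redundant dep)
      where
      shrink : ∃[ x ] (x ∈ X × r (X - x) ≡ r X) → ∃[ B ] (B ⊆ X × ¬ Dependent r B × r B ≡ r X)
      shrink (x , x∈X , r[X-x]≡r[X]) =
        let B , B⊆X-x , indep , r[B]≡r[X-x] = go (X - x) (rec (x∈p⇒p-x⊂p x∈X))
        in B , (λ y∈B → p─q⊆p X ⁅ x ⁆ (B⊆X-x y∈B)) , indep , trans r[B]≡r[X-x] r[X-x]≡r[X]

  circuit-through : ∀ {B x} → ¬ Dependent r B → Dependent r (B ∪ ⁅ x ⁆) →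
                    ∃[ C ] (IsCircuit r C × x ∈ C × C ⊆ B ∪ ⁅ x ⁆)
  circuit-through {B} {x} indep dep with dependent⇒∃circuit dep
  ... | C , C⊆B∪x , circ with x ∈? C
  ...   | yes x∈C = C , circ , x∈C , C⊆B∪x
  ...   | no x∉C = ⊥-elim (independent-⊆ C⊆B indep (proj₁ circ))
    where
    C⊆B : C ⊆ B
    C⊆B {y} y∈C with x∈p∪q⁻ B ⁅ x ⁆ (C⊆B∪x y∈C)
    ... | inj₁ y∈B   = y∈B
    ... | inj₂ y∈⁅x⁆ = ⊥-elim (x∉C (subst (_∈ C) (x∈⁅y⁆⇒x≡y x y∈⁅x⁆) y∈C))

  ∈cl⇒∃circuit : ∀ {X x} → x ∉ X → x ∈cl[ r ] X → ∃[ C ] (IsCircuit r C × x ∈ C × C ⊆ X ∪ ⁅ x ⁆)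
  ∈cl⇒∃circuit {X} {x} x∉X x∈clX = from-basis (∃-basis X)
    where
    from-basis : ∃[ B ] (B ⊆ X × ¬ Dependent r B × r B ≡ r X) →
                 ∃[ C ] (IsCircuit r C × x ∈ C × C ⊆ X ∪ ⁅ x ⁆)
    from-basis (B , B⊆X , indep , r[B]≡r[X]) =
      let C , circ , x∈C , C⊆B∪x = circuit-through indep B∪x-dependent
      in  C , circ , x∈C , λ y∈C → B∪x⊆X∪x (C⊆B∪x y∈C)
      where
      B∪x⊆X∪x : B ∪ ⁅ x ⁆ ⊆ X ∪ ⁅ x ⁆
      B∪x⊆X∪x = ∪-⊆ (λ y∈B → p⊆p∪q ⁅ x ⁆ (B⊆X y∈B)) (q⊆p∪q X ⁅ x ⁆)
      B∪x-dependent : Dependent r (B ∪ ⁅ x ⁆)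
      B∪x-dependent = begin-strict
        r (B ∪ ⁅ x ⁆)     ≤⟨ monotone M _ _ B∪x⊆X∪x ⟩
        r (X ∪ ⁅ x ⁆)     ≡⟨ trans x∈clX (sym r[B]≡r[X]) ⟩
        r B               ≤⟨ bounded M B ⟩
        ∣ B ∣             <⟨ n<1+n ∣ B ∣ ⟩
        suc ∣ B ∣         ≡⟨ sym (∣⁅x⁆∪p∣≡1+∣p∣ (λ x∈B → x∉X (B⊆X x∈B))) ⟩
        ∣ ⁅ x ⁆ ∪ B ∣     ≡⟨ cong ∣_∣ (∪-comm ⁅ x ⁆ B) ⟩
        ∣ B ∪ ⁅ x ⁆ ∣     ∎
        where open ≤-Reasoning

[a∸c]+[b∸c]≡[a+b]∸[c+c] : ∀ {a b c} → c ≤ a → c ≤ b → (a ∸ c) + (b ∸ c) ≡ (a + b) ∸ (c + c)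
[a∸c]+[b∸c]≡[a+b]∸[c+c] {a} {b} {c} c≤a c≤b = begin
  (a ∸ c) + (b ∸ c)   ≡⟨ sym (+-∸-comm (b ∸ c) c≤a) ⟩
  (a + (b ∸ c)) ∸ c   ≡⟨ cong (_∸ c) (sym (+-∸-assoc a c≤b)) ⟩
  (a + b) ∸ c ∸ c     ≡⟨ ∸-+-assoc (a + b) c c ⟩
  (a + b) ∸ (c + c)   ∎
  where open ≡-Reasoning

module Contraction {n : ℕ} (M : Matroid (suc n)) where

  open MatroidProperties M using (rank-subadditive; ⊆-same-rank-∪)

  r₀ : ℕ
  r₀ = rank M ⁅ zero ⁆

  r₀≤ : ∀ X → r₀ ≤ rank M (inside ∷ X)
  r₀≤ X = monotone M _ _ (in⊆in ⊥⊆)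

  contraction : Matroid n
  contraction = record
    { rank     = λ X → rank M (inside ∷ X) ∸ r₀
    ; bounded  = λ X → m≤n+o⇒m∸n≤o _ r₀ (begin
        rank M (inside ∷ X)                   ≤⟨ monotone M _ _ (in⊆in (q⊆p∪q ⊥ X)) ⟩
        rank M (⁅ zero ⁆ ∪ (outside ∷ X))     ≤⟨ rank-subadditive ⁅ zero ⁆ (outside ∷ X) ⟩
        r₀ + rank M (outside ∷ X)             ≤⟨ +-monoʳ-≤ r₀ (bounded M (outside ∷ X)) ⟩
        r₀ + ∣ X ∣                            ∎)
    ; monotone = λ X Y X⊆Y → ∸-monoˡ-≤ r₀ (monotone M _ _ (in⊆in X⊆Y))
    ; submod   = λ X Y → begin
        (rank M (inside ∷ (X ∪ Y)) ∸ r₀) + (rank M (inside ∷ (X ∩ Y)) ∸ r₀)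
          ≡⟨ [a∸c]+[b∸c]≡[a+b]∸[c+c] (r₀≤ (X ∪ Y)) (r₀≤ (X ∩ Y)) ⟩
        (rank M (inside ∷ (X ∪ Y)) + rank M (inside ∷ (X ∩ Y))) ∸ (r₀ + r₀)
          ≤⟨ ∸-monoˡ-≤ (r₀ + r₀) (submod M (inside ∷ X) (inside ∷ Y)) ⟩
        (rank M (inside ∷ X) + rank M (inside ∷ Y)) ∸ (r₀ + r₀)
          ≡⟨ sym ([a∸c]+[b∸c]≡[a+b]∸[c+c] (r₀≤ X) (r₀≤ Y)) ⟩
        (rank M (inside ∷ X) ∸ r₀) + (rank M (inside ∷ Y) ∸ r₀) ∎
    }
    where open ≤-Reasoning

  deletion-rank≤1+contraction-rank : ∀ X → rank M (outside ∷ X) ≤ suc (rank contraction X)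
  deletion-rank≤1+contraction-rank X = begin
    rank M (outside ∷ X)                    ≤⟨ monotone M _ _ (out⊆ (λ x∈X → x∈X)) ⟩
    rank M (inside ∷ X)                     ≤⟨ m≤n+m∸n (rank M (inside ∷ X)) r₀ ⟩
    r₀ + (rank M (inside ∷ X) ∸ r₀)         ≤⟨ +-monoˡ-≤ _ r₀≤1 ⟩
    suc (rank M (inside ∷ X) ∸ r₀)          ∎
    where
    open ≤-Reasoning
    r₀≤1 : r₀ ≤ 1
    r₀≤1 = ≤-trans (bounded M ⁅ zero ⁆) (≤-reflexive (∣⁅x⁆∣≡1 {suc n} zero))

  deletion-cl⇒contraction-cl : ∀ {X f} → f ∈cl[ (λ Y → rank M (outside ∷ Y)) ] X →
                               f ∈cl[ rank contraction ] X
  deletion-cl⇒contraction-cl {X} {f} f∈cl = cong (_∸ r₀) (≤-antisym (begin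
    rank M (inside ∷ (X ∪ ⁅ f ⁆))                  ≤⟨ monotone M _ _ (in⊆in (p⊆p∪q ⊥)) ⟩
    rank M ((outside ∷ (X ∪ ⁅ f ⁆)) ∪ ⁅ zero ⁆)    ≤⟨ ⊆-same-rank-∪ ⁅ zero ⁆ (out⊆ (p⊆p∪q ⁅ f ⁆)) f∈cl ⟩
    rank M ((outside ∷ X) ∪ ⁅ zero ⁆)              ≤⟨ monotone M _ _ (in⊆in (∪-⊆ (λ x∈X → x∈X) ⊥⊆)) ⟩
    rank M (inside ∷ X)                            ∎) (monotone M _ _ (in⊆in (p⊆p∪q ⁅ f ⁆))))
    where open ≤-Reasoning

-- M is an elementary lift of N: N is a quotient of M of corank at most one.
record ElementaryLift (M N : Matroid n) : Set where
  field
    rank-≤-suc : ∀ X → rank M X ≤ suc (rank N X)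
    cl-⊆       : ∀ {X f} → f ∈cl[ rank M ] X → f ∈cl[ rank N ] X

deletion-elementaryLift : ∀ (M′ : Matroid (suc n)) (M : Matroid n) →
  (∀ X → rank M′ (outside ∷ X) ≡ rank M X) → ElementaryLift M (Contraction.contraction M′)
deletion-elementaryLift M′ M deletion≡M = record
  { rank-≤-suc = λ X → subst (_≤ _) (deletion≡M X) (deletion-rank≤1+contraction-rank X)
  ; cl-⊆       = λ {X} {f} f∈cl → deletion-cl⇒contraction-cl
      (trans (deletion≡M (X ∪ ⁅ f ⁆)) (trans f∈cl (sym (deletion≡M X))))
  }
  where open Contraction M′

module Reachability {m : ℕ} {R : Fin m → Fin m → Set} (R? : ∀ u v → Dec (R u v)) (a : Fin m) where

  Reached : Subset m → Set
  Reached S = ∀ {u} → u ∈ S → Star R a u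

  Closed : Subset m → Set
  Closed S = ∀ {u v} → u ∈ S → R u v → v ∈ S

  Closed-Star : ∀ {S u v} → Closed S → u ∈ S → Star R u v → v ∈ S
  Closed-Star closed u∈S ε          = u∈S
  Closed-Star closed u∈S (uRw ◅ w⇝v) = Closed-Star closed (closed u∈S uRw) w⇝v

  reachable-set : ∃[ S ] (Reached S × a ∈ S × Closed S)
  reachable-set = grow ⁅ a ⁆ reached-a (x∈⁅x⁆ a) (⊃-wellFounded _)
    where
    reached-a : Reached ⁅ a ⁆
    reached-a u∈⁅a⁆ rewrite x∈⁅y⁆⇒x≡y a u∈⁅a⁆ = ε
    grow : ∀ S → Reached S → a ∈ S → Acc _⊃_ S → ∃[ T ] (Reached T × a ∈ T × Closed T)
    grow S reached a∈S (acc rec)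
      with any? (λ u → any? (λ v → (u ∈? S) ×-dec (R? u v ×-dec ¬? (v ∈? S))))
    ... | yes (u , v , u∈S , uRv , v∉S) =
      grow (⁅ v ⁆ ∪ S) reached′ (q⊆p∪q ⁅ v ⁆ S a∈S)
           (rec (q⊆p∪q ⁅ v ⁆ S , v , x∈p∪q⁺ (inj₁ (x∈⁅x⁆ v)) , v∉S))
      where
      reached′ : Reached (⁅ v ⁆ ∪ S)
      reached′ w∈ with x∈p∪q⁻ ⁅ v ⁆ S w∈
      ... | inj₁ w∈⁅v⁆ rewrite x∈⁅y⁆⇒x≡y v w∈⁅v⁆ = reached u∈S ◅◅ (uRv ◅ ε)
      ... | inj₂ w∈S = reached w∈S
    ... | no ¬exit = S , reached , a∈S ,
      λ {u} {v} u∈S uRv → decidable-stable (v ∈? S) (λ v∉S → ¬exit (u , v , u∈S , uRv , v∉S))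

  reachable? : ∀ v → Dec (Star R a v)
  reachable? v with reachable-set
  ... | S , reached , a∈S , closed with v ∈? S
  ...   | yes v∈S = yes (reached v∈S)
  ...   | no v∉S  = no (λ a⇝v → v∉S (Closed-Star closed a∈S a⇝v))

-- Constructive form of "the classes of ~ that meet V number at most two".
at-most-two-classes : ∀ {V : Fin m → Set} {_~_ : Fin m → Fin m → Set} →
  (∀ v → Dec (V v)) → (∀ u v → Dec (u ~ v)) → ∀ {x₀} → V x₀ →
  (∀ {x y z} → V x → V y → V z → ¬ x ~ y → ¬ x ~ z → ¬ ¬ y ~ z) →
  ∃[ a ] ∃[ b ] (∀ v → V v → a ~ v ⊎ b ~ v)
at-most-two-classes {V = V} {_~_} V? _~?_ {x₀} Vx₀ no-third
  with any? (λ v → V? v ×-dec ¬? (x₀ ~? v))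
... | no ¬outsider = x₀ , x₀ , λ v Vv →
  inj₁ (decidable-stable (x₀ ~? v) (λ ¬x₀~v → ¬outsider (v , Vv , ¬x₀~v)))
... | yes (b , Vb , ¬x₀~b) = x₀ , b , cover
  where
  cover : ∀ v → V v → x₀ ~ v ⊎ b ~ v
  cover v Vv with x₀ ~? v | b ~? v
  ... | yes x₀~v | _       = inj₁ x₀~v
  ... | no _     | yes b~v = inj₂ b~v
  ... | no ¬x₀~v | no ¬b~v = ⊥-elim (no-third Vx₀ Vb Vv ¬x₀~b ¬x₀~v ¬b~v)

module GraphProperties {m n : ℕ} (G : Graph m n) where

  Joins : Fin n → Fin m → Fin m → Set
  Joins e u v = (src G e ≡ u × tgt G e ≡ v) ⊎ (src G e ≡ v × tgt G e ≡ u)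

  Joins-sym : ∀ {e u v} → Joins e u v → Joins e v u
  Joins-sym (inj₁ ends) = inj₂ ends
  Joins-sym (inj₂ ends) = inj₁ ends

  Joins⇒end : ∀ {e u v} → Joins e u v → src G e ≡ u ⊎ tgt G e ≡ u
  Joins⇒end (inj₁ (refl , _)) = inj₁ refl
  Joins⇒end (inj₂ (_ , refl)) = inj₂ refl

  Adj-sym : ∀ {X u v} → Adj G X u v → Adj G X v u
  Adj-sym (e , e∈X , j) = e , e∈X , Joins-sym j

  Conn-sym : ∀ {X u v} → Conn G X u v → Conn G X v u
  Conn-sym = reverse Adj-sym

  Conn-mono : ∀ {X Y u v} → X ⊆ Y → Conn G X u v → Conn G Y u v
  Conn-mono X⊆Y = Star.map (λ (e , e∈X , j) → e , X⊆Y e∈X , j)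

  EndsIn : Subset n → Subset m → Set
  EndsIn X W = ∀ {e} → e ∈ X → src G e ∈ W × tgt G e ∈ W

  Joins-ends : ∀ {e u v W} → Joins e u v → src G e ∈ W × tgt G e ∈ W → u ∈ W × v ∈ W
  Joins-ends (inj₁ (refl , refl)) (s , t) = s , t
  Joins-ends (inj₂ (refl , refl)) (s , t) = t , s

  Joins-ends⁺ : ∀ {e u v W} → Joins e u v → u ∈ W → v ∈ W → src G e ∈ W × tgt G e ∈ W
  Joins-ends⁺ (inj₁ (refl , refl)) u∈W v∈W = u∈W , v∈W
  Joins-ends⁺ (inj₂ (refl , refl)) u∈W v∈W = v∈W , u∈W

  EndsIn-vertex : ∀ {X W v} → EndsIn X W → VertexOf G X v → v ∈ W
  EndsIn-vertex ends (e , e∈X , inj₁ refl) = proj₁ (ends e∈X)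
  EndsIn-vertex ends (e , e∈X , inj₂ refl) = proj₂ (ends e∈X)

  EndsIn-∉ : ∀ {E W e u v} → EndsIn E W → Joins e u v → u ∉ W → e ∉ E
  EndsIn-∉ ends j u∉W e∈E = u∉W (proj₁ (Joins-ends j (ends e∈E)))

  ind-refl : ∀ a → ind G a a ≡ 1
  ind-refl a =
    cong (λ b → if b then 1 else 0) (trans (isYes≗does (a ≟ᶠ a)) (dec-true (a ≟ᶠ a) refl))

  ind-≢ : ∀ {a b} → a ≢ b → ind G a b ≡ 0
  ind-≢ {a} {b} a≢b =
    cong (λ b → if b then 1 else 0) (trans (isYes≗does (a ≟ᶠ b)) (dec-false (a ≟ᶠ b) a≢b))

  ind-positive : ∀ {a b} → 0 < ind G a b → a ≡ b
  ind-positive {a} {b} pos =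
    decidable-stable (a ≟ᶠ b) (λ a≢b → <-irrefl refl (subst (0 <_) (ind-≢ a≢b) pos))

  incidences : Fin n → Fin m → ℕ
  incidences e v = ind G (src G e) v + ind G (tgt G e) v

  degree≡sumOver : ∀ X v → degree G X v ≡ sumOver X (λ e → incidences e v)
  degree≡sumOver X v = sum-allFin-if≡sumOver X (λ e → incidences e v)

  incidences-Joins : ∀ {e a b} → Joins e a b → ∀ v → incidences e v ≡ ind G a v + ind G b v
  incidences-Joins (inj₁ (refl , refl)) v = refl
  incidences-Joins {e} (inj₂ (refl , refl)) v = +-comm (ind G (src G e) v) _

  incidences-link : ∀ {e u w} → Joins e u w → u ≢ w → incidences e u ≡ 1
  incidences-link {u = u} j u≢w =
    trans (incidences-Joins j u) (cong₂ _+_ (ind-refl u) (ind-≢ (λ w≡u → u≢w (sym w≡u))))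

  incidences-end : ∀ {e v} → src G e ≡ v ⊎ tgt G e ≡ v → 1 ≤ incidences e v
  incidences-end {v = v} (inj₁ refl) = m≤n⇒m≤n+o _ (≤-reflexive (sym (ind-refl v)))
  incidences-end {v = v} (inj₂ refl) = m≤n⇒m≤o+n _ (≤-reflexive (sym (ind-refl v)))

  incidences-positive : ∀ {e v} → 0 < incidences e v → ∃[ w ] Joins e v w
  incidences-positive {e} {v} pos with ind G (src G e) v in eq
  ... | suc _ = tgt G e , inj₁ (ind-positive (subst (0 <_) (sym eq) z<s) , refl)
  ... | zero  = src G e , inj₂ (refl , ind-positive pos)

  incidences≡0 : ∀ {e v} → incidences e v ≡ 0 → src G e ≢ v × tgt G e ≢ v
  incidences≡0 none = (λ src≡v → 1+n≰n (subst (1 ≤_) none (incidences-end (inj₁ src≡v)))) ,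
                      (λ tgt≡v → 1+n≰n (subst (1 ≤_) none (incidences-end (inj₂ tgt≡v))))

  degree-outside : ∀ {E W v} → EndsIn E W → v ∉ W → sumOver E (λ e → incidences e v) ≡ 0
  degree-outside {E} {v = v} ends v∉W = sumOver-zero E λ {e} e∈E →
    cong₂ _+_ (ind-≢ {src G e} {v} (λ { refl → v∉W (proj₁ (ends e∈E)) }))
              (ind-≢ {tgt G e} {v} (λ { refl → v∉W (proj₂ (ends e∈E)) }))

  Adj? : ∀ X u v → Dec (Adj G X u v)
  Adj? X u v = any? λ e → (e ∈? X) ×-dec
    (((src G e ≟ᶠ u) ×-dec (tgt G e ≟ᶠ v)) ⊎-dec ((src G e ≟ᶠ v) ×-dec (tgt G e ≟ᶠ u)))

  Conn? : ∀ X u v → Dec (Conn G X u v)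
  Conn? X u = Reachability.reachable? (Adj? X) u

  VertexOf? : ∀ X v → Dec (VertexOf G X v)
  VertexOf? X v = any? λ e → (e ∈? X) ×-dec ((src G e ≟ᶠ v) ⊎-dec (tgt G e ≟ᶠ v))

  ∈edgesAvoiding⁻ : ∀ {e v} → e ∈ edgesAvoiding G v → src G e ≢ v × tgt G e ≢ v
  ∈edgesAvoiding⁻ {e} {v} e∈ =
    neither (src G e ≟ᶠ v) (tgt G e ≟ᶠ v) (trans (sym (lookup∘tabulate _ e)) ([]=⇒lookup e∈))
    where
    neither : ∀ {A B : Set} (a? : Dec A) (b? : Dec B) →
              (if ⌊ a? ⌋ then false else if ⌊ b? ⌋ then false else true) ≡ true → ¬ A × ¬ B
    neither (no ¬a) (no ¬b) _ = ¬a , ¬b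

  ∈edgesAvoiding⁺ : ∀ {e v} → src G e ≢ v → tgt G e ≢ v → e ∈ edgesAvoiding G v
  ∈edgesAvoiding⁺ {e} {v} src≢v tgt≢v =
    lookup⇒[]= e _ (trans (lookup∘tabulate _ e) (neither (src G e ≟ᶠ v) (tgt G e ≟ᶠ v) src≢v tgt≢v))
    where
    neither : ∀ {A B : Set} (a? : Dec A) (b? : Dec B) → ¬ A → ¬ B →
              (if ⌊ a? ⌋ then false else if ⌊ b? ⌋ then false else true) ≡ true
    neither (yes a) _       ¬a ¬b = ⊥-elim (¬a a)
    neither (no _)  (yes b) ¬a ¬b = ⊥-elim (¬b b)
    neither (no _)  (no _)  ¬a ¬b = refl

  -- A path from a to b with edge set E and vertex set V; a ∉ V keeps it simple.
  data Path : Fin m → Fin m → Subset n → Subset m → Set where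
    [_]  : ∀ a → Path a a ⊥ ⁅ a ⁆
    step : ∀ {e a a′ b E V} → Joins e a a′ → a ∉ V → Path a′ b E V →
           Path a b (⁅ e ⁆ ∪ E) (⁅ a ⁆ ∪ V)

  path-ends : ∀ {a b E V} → Path a b E V → a ∈ V × b ∈ V
  path-ends [ a ]          = x∈⁅x⁆ a , x∈⁅x⁆ a
  path-ends (step j _ p) = x∈p∪q⁺ (inj₁ (x∈⁅x⁆ _)) , x∈p∪q⁺ (inj₂ (proj₂ (path-ends p)))

  path-edges : ∀ {a b E V} → Path a b E V → EndsIn E V
  path-edges [ a ] e∈⊥ = ⊥-elim (∉⊥ e∈⊥)
  path-edges (step {e} {E = E} {V} j a∉V p) e′∈ with x∈p∪q⁻ ⁅ e ⁆ E e′∈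
  ... | inj₁ e′∈⁅e⁆ rewrite x∈⁅y⁆⇒x≡y e e′∈⁅e⁆ =
    Joins-ends⁺ j (x∈p∪q⁺ (inj₁ (x∈⁅x⁆ _))) (x∈p∪q⁺ (inj₂ (proj₁ (path-ends p))))
  ... | inj₂ e′∈E = let s , t = path-edges p e′∈E in x∈p∪q⁺ (inj₂ s) , x∈p∪q⁺ (inj₂ t)

  path-reaches : ∀ {a b E V u} → Path a b E V → u ∈ V → Conn G E a u
  path-reaches [ a ] u∈⁅a⁆ rewrite x∈⁅y⁆⇒x≡y a u∈⁅a⁆ = ε
  path-reaches (step {e} {a} {E = E} {V} j _ p) u∈ with x∈p∪q⁻ ⁅ a ⁆ V u∈
  ... | inj₁ u∈⁅a⁆ rewrite x∈⁅y⁆⇒x≡y a u∈⁅a⁆ = ε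
  ... | inj₂ u∈V = (e , x∈p∪q⁺ (inj₁ (x∈⁅x⁆ e)) , j) ◅ Conn-mono (q⊆p∪q ⁅ e ⁆ E) (path-reaches p u∈V)

  path-prefix : ∀ {a b E V y} → Path a b E V → y ∈ V →
                ∃[ E′ ] ∃[ V′ ] (Path a y E′ V′ × E′ ⊆ E × V′ ⊆ V)
  path-prefix [ a ] y∈⁅a⁆ rewrite x∈⁅y⁆⇒x≡y a y∈⁅a⁆ = ⊥ , ⁅ a ⁆ , [ a ] , ⊥⊆ , (λ v∈ → v∈)
  path-prefix (step {e} {a} {E = E} {V} j a∉V p) y∈ with x∈p∪q⁻ ⁅ a ⁆ V y∈
  ... | inj₁ y∈⁅a⁆ rewrite x∈⁅y⁆⇒x≡y a y∈⁅a⁆ = ⊥ , ⁅ a ⁆ , [ a ] , ⊥⊆ , p⊆p∪q V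
  ... | inj₂ y∈V with path-prefix p y∈V
  ...   | E′ , V′ , p′ , E′⊆E , V′⊆V =
          ⁅ e ⁆ ∪ E′ , ⁅ a ⁆ ∪ V′ , step j (λ a∈V′ → a∉V (V′⊆V a∈V′)) p′ ,
          ∪-⊆ (p⊆p∪q E) (λ e′∈E′ → q⊆p∪q ⁅ e ⁆ E (E′⊆E e′∈E′)) ,
          ∪-⊆ (p⊆p∪q V) (λ v∈V′ → q⊆p∪q ⁅ a ⁆ V (V′⊆V v∈V′))

  -- Each vertex of a path is counted twice: by its incident path edges and by
  -- its being an end of the path.
  path-handshake : ∀ {a b E V v} → Path a b E V → v ∈ V →
                   sumOver E (λ e → incidences e v) + (ind G a v + ind G b v) ≡ 2
  path-handshake [ a ] v∈⁅a⁆ rewrite x∈⁅y⁆⇒x≡y a v∈⁅a⁆ =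
    cong₂ _+_ (sumOver-zero {n} ⊥ (λ e∈⊥ → ⊥-elim (∉⊥ e∈⊥))) (cong₂ _+_ (ind-refl a) (ind-refl a))
  path-handshake {v = v} (step {e} {a} {a′} {b} {E} {V} j a∉V p) v∈ =
    trans (cong (_+ (ind G a v + ind G b v)) (trans (sumOver-insert E h e∉E)
                                                    (cong (_+ sumOver E h) (incidences-Joins j v))))
          (by-position (x∈p∪q⁻ ⁅ a ⁆ V v∈))
    where
    h : Fin n → ℕ
    h e = incidences e v
    e∉E : e ∉ E
    e∉E = EndsIn-∉ (path-edges p) j a∉V
    by-position : v ∈ ⁅ a ⁆ ⊎ v ∈ V →
                  ind G a v + ind G a′ v + sumOver E h + (ind G a v + ind G b v) ≡ 2
    by-position (inj₁ v∈⁅a⁆) rewrite x∈⁅y⁆⇒x≡y a v∈⁅a⁆ =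
      cong₂ _+_ (cong₂ _+_ (cong₂ _+_ (ind-refl a) (ind-≢ (λ { refl → a∉V (proj₁ (path-ends p)) })))
                           (degree-outside (path-edges p) a∉V))
                (cong₂ _+_ (ind-refl a) (ind-≢ (λ { refl → a∉V (proj₂ (path-ends p)) })))
    by-position (inj₂ v∈V) = begin
      ind G a v + ind G a′ v + sumOver E h + (ind G a v + ind G b v)
        ≡⟨ cong₂ (λ x y → x + ind G a′ v + sumOver E h + (y + ind G b v)) a-absent a-absent ⟩
      ind G a′ v + sumOver E h + ind G b v
        ≡⟨ xy∙z≈y∙xz (ind G a′ v) (sumOver E h) (ind G b v) ⟩
      sumOver E h + (ind G a′ v + ind G b v)
        ≡⟨ path-handshake p v∈V ⟩
      2 ∎
      where
      open ≡-Reasoning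
      a-absent : ind G a v ≡ 0
      a-absent = ind-≢ (λ { refl → a∉V v∈V })

  closing-edge⇒cycle : ∀ {b y g E V} → Path b y E V → Joins g y b → g ∉ E → IsCycle G (⁅ g ⁆ ∪ E)
  closing-edge⇒cycle {b} {y} {g} {E} {V} p j g∉E =
    (g , x∈p∪q⁺ (inj₁ (x∈⁅x⁆ g))) , connected , 2-regular
    where
    Z = ⁅ g ⁆ ∪ E
    ends : EndsIn Z V
    ends e∈Z with x∈p∪q⁻ ⁅ g ⁆ E e∈Z
    ... | inj₁ e∈⁅g⁆ rewrite x∈⁅y⁆⇒x≡y g e∈⁅g⁆ =
      Joins-ends⁺ j (proj₂ (path-ends p)) (proj₁ (path-ends p))
    ... | inj₂ e∈E = path-edges p e∈E
    reaches : ∀ {u} → u ∈ V → Conn G Z b u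
    reaches u∈V = Conn-mono (q⊆p∪q ⁅ g ⁆ E) (path-reaches p u∈V)
    connected : ∀ e f → e ∈ Z → f ∈ Z → Conn G Z (src G e) (src G f)
    connected e f e∈Z f∈Z = Conn-sym (reaches (proj₁ (ends e∈Z))) ◅◅ reaches (proj₁ (ends f∈Z))
    2-regular : ∀ v → VertexOf G Z v → degree G Z v ≡ 2
    2-regular v v∈Z = begin
      degree G Z v                           ≡⟨ degree≡sumOver Z v ⟩
      sumOver Z h                            ≡⟨ sumOver-insert E h g∉E ⟩
      incidences g v + sumOver E h           ≡⟨ cong (_+ sumOver E h) (incidences-Joins (Joins-sym j) v) ⟩
      ind G b v + ind G y v + sumOver E h    ≡⟨ +-comm (ind G b v + ind G y v) (sumOver E h) ⟩
      sumOver E h + (ind G b v + ind G y v)  ≡⟨ path-handshake p (EndsIn-vertex ends v∈Z) ⟩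
      2                                      ∎
      where
      open ≡-Reasoning
      h : Fin n → ℕ
      h e = incidences e v

  HasCycle : Subset n → Set
  HasCycle X = ∃[ Z ] (Z ⊆ X × IsCycle G Z)

  MinDegree2 : Subset n → Set
  MinDegree2 X = ∀ v → VertexOf G X v → 2 ≤ degree G X v

  another-edge : ∀ {X g y b} → MinDegree2 X → g ∈ X → Joins g y b → y ≢ b →
                 ∃[ g′ ] (g′ ∈ X × g′ ≢ g × ∃[ y′ ] Joins g′ y y′)
  another-edge {X} {g} {y} md g∈X j y≢b
    with any? (λ g′ → (g′ ∈? X) ×-dec (¬? (g′ ≟ᶠ g) ×-dec (0 <? incidences g′ y)))
  ... | yes (g′ , g′∈X , g′≢g , pos) = g′ , g′∈X , g′≢g , incidences-positive pos
  ... | no ¬another = ⊥-elim (1+n≰n (subst (2 ≤_) degree≡1 (md y (g , g∈X , Joins⇒end j))))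
    where
    others : ∀ {g′} → g′ ∈ X → g′ ≢ g → incidences g′ y ≡ 0
    others g′∈X g′≢g = n≤0⇒n≡0 (≮⇒≥ (λ pos → ¬another (_ , g′∈X , g′≢g , pos)))
    degree≡1 : degree G X y ≡ 1
    degree≡1 = trans (degree≡sumOver X y)
                     (trans (sumOver-single X (λ e → incidences e y) g∈X others) (incidences-link j y≢b))

  -- Walk along unused edges, which exist by MinDegree2, until the far end of
  -- the current edge g is already on the path; the vertex set grows each step.
  cycle-search : ∀ {X a b y g E V} → MinDegree2 X → Path b a E V → E ⊆ X →
                 g ∈ X → g ∉ E → Joins g b y → Acc _⊃_ V → HasCycle X
  cycle-search {X} {y = y} {g} {E} {V} md p E⊆X g∈X g∉E j (acc rec) with y ∈? V
  ... | yes y∈V with path-prefix p y∈V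
  ...   | E′ , _ , p′ , E′⊆E , _ =
          ⁅ g ⁆ ∪ E′ , ∪-⊆ (x∈p⇒⁅x⁆⊆p g∈X) (λ e∈E′ → E⊆X (E′⊆E e∈E′)) ,
          closing-edge⇒cycle p′ (Joins-sym j) (λ g∈E′ → g∉E (E′⊆E g∈E′))
  cycle-search {X} {b = b} {y} {g} {E} {V} md p E⊆X g∈X g∉E j (acc rec) | no y∉V
    with another-edge md g∈X (Joins-sym j) (λ { refl → y∉V (proj₁ (path-ends p)) })
  ... | g′ , g′∈X , g′≢g , _ , j′ =
    cycle-search md (step (Joins-sym j) y∉V p) (∪-⊆ (x∈p⇒⁅x⁆⊆p g∈X) E⊆X) g′∈X g′∉ j′
                 (rec (q⊆p∪q ⁅ y ⁆ V , y , x∈p∪q⁺ (inj₁ (x∈⁅x⁆ y)) , y∉V))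
    where
    g′∉ : g′ ∉ ⁅ g ⁆ ∪ E
    g′∉ g′∈ with x∈p∪q⁻ ⁅ g ⁆ E g′∈
    ... | inj₁ g′∈⁅g⁆ = g′≢g (x∈⁅y⁆⇒x≡y g g′∈⁅g⁆)
    ... | inj₂ g′∈E   = EndsIn-∉ (path-edges p) j′ y∉V g′∈E

  minDegree2⇒cycle : ∀ {X} → Nonempty X → MinDegree2 X → HasCycle X
  minDegree2⇒cycle (e , e∈X) md =
    cycle-search md [ src G e ] ⊥⊆ e∈X ∉⊥ (inj₁ (refl , refl)) (⊃-wellFounded _)

  record Leaf (X : Subset n) : Set where
    field
      vertex other : Fin m
      edge         : Fin n
      edge∈X       : edge ∈ X
      joins        : Joins edge vertex other
      vertex≢other : vertex ≢ other
      pendant      : ∀ {g} → g ∈ X → g ≢ edge → incidences g vertex ≡ 0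

  degree-1⇒Leaf : ∀ {X u} → degree G X u ≡ 1 → Leaf X
  degree-1⇒Leaf {X} {u} deg≡1
    with sumOver-positive X (λ e → incidences e u)
                          (subst (0 <_) (trans (sym deg≡1) (degree≡sumOver X u)) z<s)
  ... | f , f∈X , pos with incidences-positive pos
  ...   | w , j = record
    { vertex = u ; other = w ; edge = f ; edge∈X = f∈X ; joins = j
    ; vertex≢other = λ { refl → 1+n≰n (≤-trans (≤-reflexive (sym (loop j))) f≤1) }
    ; pendant = λ g∈X g≢f → n≤0⇒n≡0 (s≤s⁻¹ (≤-trans (+-monoˡ-≤ _ pos) (two-terms≤1 g∈X g≢f)))
    }
    where
    h : Fin n → ℕ
    h e = incidences e u
    sum≡1 : sumOver X h ≡ 1
    sum≡1 = trans (sym (degree≡sumOver X u)) deg≡1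
    f≤1 : h f ≤ 1
    f≤1 = subst (h f ≤_) sum≡1 (term≤sumOver h f∈X)
    two-terms≤1 : ∀ {g} → g ∈ X → g ≢ f → h f + h g ≤ 1
    two-terms≤1 {g} g∈X g≢f = subst (h f + h g ≤_) sum≡1 (two-terms≤sumOver X h f∈X g∈X g≢f)
    loop : Joins f u u → h f ≡ 2
    loop j = trans (incidences-Joins j u) (cong₂ _+_ (ind-refl u) (ind-refl u))

  acyclic⇒Leaf : ∀ {X} → Nonempty X → ¬ HasCycle X → Leaf X
  acyclic⇒Leaf {X} ne acyclic with any? (λ u → degree G X u ≟ 1)
  ... | yes (u , deg≡1) = degree-1⇒Leaf deg≡1
  ... | no ¬leaf = ⊥-elim (acyclic (minDegree2⇒cycle ne minDegree2))
    where
    minDegree2 : MinDegree2 X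
    minDegree2 v (e , e∈X , end) =
      ≤∧≢⇒< (≤-trans (incidences-end end) (subst (_ ≤_) (sym (degree≡sumOver X v)) (term≤sumOver _ e∈X)))
             (λ 1≡deg → ¬leaf (v , sym 1≡deg))

  forest-bound : ∀ {X W} → ¬ HasCycle X → EndsIn X W → Nonempty W → suc ∣ X ∣ ≤ ∣ W ∣
  forest-bound {X} = go X (⊂-wellFounded X)
    where
    go : ∀ X → Acc _⊂_ X → ∀ {W} → ¬ HasCycle X → EndsIn X W → Nonempty W → suc ∣ X ∣ ≤ ∣ W ∣
    go X (acc rec) {W} acyclic ends (w , w∈W) with ∣p∣≡0⊎Nonempty X
    ... | inj₁ ∣X∣≡0 = subst (λ k → suc k ≤ ∣ W ∣) (sym ∣X∣≡0) (x∈p⇒∣p∣>0 w∈W)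
    ... | inj₂ ne = begin
      suc ∣ X ∣               ≡⟨ cong suc (∣p∣≡1+∣p-x∣ f∈X) ⟩
      suc (suc ∣ X - f ∣)     ≤⟨ s≤s (go (X - f) (rec (x∈p⇒p-x⊂p f∈X)) acyclic′ ends′ (w′ , w′∈W-u)) ⟩
      suc ∣ W - u ∣           ≡⟨ sym (∣p∣≡1+∣p-x∣ u∈W) ⟩
      ∣ W ∣                   ∎
      where
      open ≤-Reasoning
      open Leaf (acyclic⇒Leaf ne acyclic) renaming (vertex to u; other to w′; edge to f; edge∈X to f∈X)
      u∈W : u ∈ W
      u∈W = proj₁ (Joins-ends joins (ends f∈X))
      w′∈W-u : w′ ∈ W - u
      w′∈W-u = x∈p∧x≢y⇒x∈p-y (proj₂ (Joins-ends joins (ends f∈X))) (λ w′≡u → vertex≢other (sym w′≡u))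
      acyclic′ : ¬ HasCycle (X - f)
      acyclic′ (Z , Z⊆X-f , cyc) = acyclic (Z , (λ e∈Z → p─q⊆p X ⁅ f ⁆ (Z⊆X-f e∈Z)) , cyc)
      ends′ : EndsIn (X - f) (W - u)
      ends′ {e} e∈X-f =
        let e∈X = p─q⊆p X ⁅ f ⁆ e∈X-f
            src≢u , tgt≢u = incidences≡0 (pendant e∈X (λ { refl → x∉p-x X f e∈X-f }))
        in x∈p∧x≢y⇒x∈p-y (proj₁ (ends e∈X)) src≢u , x∈p∧x≢y⇒x∈p-y (proj₂ (ends e∈X)) tgt≢u

  module _ (N : Matroid n) (cycle-dependent : ∀ Z → IsCycle G Z → Dependent (rank N) Z) where
    open MatroidProperties N using (∃-basis; independent-⊆)

    rank<∣vertices∣ : ∀ {X W} → EndsIn X W → Nonempty W → suc (rank N X) ≤ ∣ W ∣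
    rank<∣vertices∣ {X} {W} ends ne with ∃-basis X
    ... | B , B⊆X , indep , r[B]≡r[X] = begin
      suc (rank N X)  ≡⟨ cong suc (sym r[B]≡r[X]) ⟩
      suc (rank N B)  ≤⟨ s≤s (bounded N B) ⟩
      suc ∣ B ∣       ≤⟨ forest-bound acyclic (λ e∈B → ends (B⊆X e∈B)) ne ⟩
      ∣ W ∣           ∎
      where
      open ≤-Reasoning
      acyclic : ¬ HasCycle B
      acyclic (Z , Z⊆B , cyc) = independent-⊆ Z⊆B indep (cycle-dependent Z cyc)

module Framework {m n : ℕ} {M N : Matroid n} (lift : ElementaryLift M N) (G : Graph m n)
  (graphic : ∀ C → (IsCircuit (rank N) C → IsCycle G C) × (IsCycle G C → IsCircuit (rank N) C)) where

  open ElementaryLift lift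
  open GraphProperties G
  private
    module M = MatroidProperties M
    module N = MatroidProperties N

  component-rank : ∀ v (S : Subset n) (W : Subset m) →
    (∀ e → (e ∈ S → Conn G ⊤ v (src G e)) × (Conn G ⊤ v (src G e) → e ∈ S)) →
    (∀ u → (u ∈ W → Conn G ⊤ v u) × (Conn G ⊤ v u → u ∈ W)) →
    rank M S ≤ ∣ W ∣
  component-rank v S W edges vertices =
    ≤-trans (rank-≤-suc S)
            (rank<∣vertices∣ N (λ Z cyc → proj₁ (proj₂ (graphic Z) cyc)) ends (v , proj₂ (vertices v) ε))
    where
    ends : EndsIn S W
    ends {e} e∈S = proj₂ (vertices _) v⇝src ,
                   proj₂ (vertices _) (v⇝src ◅◅ ((e , ∈⊤ , inj₁ (refl , refl)) ◅ ε))
      where v⇝src = proj₁ (edges e) e∈S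

  link-∉cl : ∀ {f v w} → Joins f v w → v ≢ w → ¬ f ∈cl[ rank M ] (edgesAvoiding G v)
  link-∉cl {f} {v} j v≢w f∈cl = no-circuit (N.∈cl⇒∃circuit f∉X (cl-⊆ f∈cl))
    where
    X = edgesAvoiding G v
    f∉X : f ∉ X
    f∉X f∈X with Joins⇒end j | ∈edgesAvoiding⁻ f∈X
    ... | inj₁ src≡v | src≢v , _ = src≢v src≡v
    ... | inj₂ tgt≡v | _ , tgt≢v = tgt≢v tgt≡v
    no-circuit : ¬ (∃[ Z ] (IsCircuit (rank N) Z × f ∈ Z × Z ⊆ X ∪ ⁅ f ⁆))
    no-circuit (Z , circ , f∈Z , Z⊆X∪f) = 1+n≰n (subst (2 ≤_) degree≡1 (≤-reflexive (sym degree≡2)))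
      where
      degree≡2 : degree G Z v ≡ 2
      degree≡2 = proj₂ (proj₂ (proj₁ (graphic Z) circ)) v (f , f∈Z , Joins⇒end j)
      others : ∀ {g} → g ∈ Z → g ≢ f → incidences g v ≡ 0
      others {g} g∈Z g≢f with x∈p∪q⁻ X ⁅ f ⁆ (Z⊆X∪f g∈Z)
      ... | inj₁ g∈X   = let src≢v , tgt≢v = ∈edgesAvoiding⁻ g∈X
                         in  cong₂ _+_ (ind-≢ src≢v) (ind-≢ tgt≢v)
      ... | inj₂ g∈⁅f⁆ = ⊥-elim (g≢f (x∈⁅y⁆⇒x≡y f g∈⁅f⁆))
      degree≡1 : degree G Z v ≡ 1
      degree≡1 = trans (degree≡sumOver Z v)
                       (trans (sumOver-single Z (λ e → incidences e v) f∈Z others) (incidences-link j v≢w))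

  vertex-closure : ∀ v f → f ∈cl[ rank M ] (edgesAvoiding G v) →
                   f ∈ edgesAvoiding G v ⊎ (src G f ≡ v × tgt G f ≡ v)
  vertex-closure v f f∈cl with src G f ≟ᶠ v | tgt G f ≟ᶠ v
  ... | no src≢v  | no tgt≢v  = inj₁ (∈edgesAvoiding⁺ src≢v tgt≢v)
  ... | yes src≡v | yes tgt≡v = inj₂ (src≡v , tgt≡v)
  ... | yes src≡v | no tgt≢v  =
    ⊥-elim (link-∉cl (inj₁ (src≡v , refl)) (λ v≡tgt → tgt≢v (sym v≡tgt)) f∈cl)
  ... | no src≢v  | yes tgt≡v =
    ⊥-elim (link-∉cl (inj₂ (refl , tgt≡v)) (λ v≡src → src≢v (sym v≡src)) f∈cl)

  N-CircuitAt : Subset n → Fin m → Subset n → Set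
  N-CircuitAt C x Z = IsCircuit (rank N) Z × Z ⊆ C × (∀ {g} → g ∈ Z → Conn G C x (src G g))

  N-circuit-at : ∀ {C x} → IsCircuit (rank M) C → VertexOf G C x → ∃ (N-CircuitAt C x)
  N-circuit-at {C} {x} circ (f , f∈C , end) =
    from-fundamental (N.∈cl⇒∃circuit (x∉p-x C f) (cl-⊆ (M.circuit-∈cl circ f∈C)))
    where
    x⇝src : src G f ≡ x ⊎ tgt G f ≡ x → Conn G C x (src G f)
    x⇝src (inj₁ refl)  = ε
    x⇝src (inj₂ tgt≡x) = (f , f∈C , inj₂ (refl , tgt≡x)) ◅ ε
    from-fundamental : ∃[ Z ] (IsCircuit (rank N) Z × f ∈ Z × Z ⊆ (C - f) ∪ ⁅ f ⁆) →
                       ∃ (N-CircuitAt C x)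
    from-fundamental (Z , circZ , f∈Z , Z⊆) = Z , circZ , Z⊆C , λ g∈Z →
      x⇝src end ◅◅ Conn-mono Z⊆C (proj₁ (proj₂ (proj₁ (graphic Z) circZ)) f _ f∈Z g∈Z)
      where
      Z⊆C : Z ⊆ C
      Z⊆C g∈Z = subst (_ ∈_) (x∈p⇒[p-x]∪⁅x⁆≡p f∈C) (Z⊆ g∈Z)

  N-CircuitAt-disjoint : ∀ {C a b Za Zb} → ¬ Conn G C a b →
                         N-CircuitAt C a Za → N-CircuitAt C b Zb → Disjoint Za Zb
  N-CircuitAt-disjoint ¬a⇝b (_ , _ , a⇝) (_ , _ , b⇝) g∈Za g∈Zb = ¬a⇝b (a⇝ g∈Za ◅◅ Conn-sym (b⇝ g∈Zb))

  no-three-components : ∀ {C x y z} → IsCircuit (rank M) C →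
    VertexOf G C x → VertexOf G C y → VertexOf G C z →
    ¬ Conn G C x y → ¬ Conn G C x z → ¬ ¬ Conn G C y z
  no-three-components {C} {x} {y} {z} circ vx vy vz ¬x⇝y ¬x⇝z =
    three-disjoint (N-circuit-at circ vx) (N-circuit-at circ vy) (N-circuit-at circ vz)
    where
    three-disjoint : ∃ (N-CircuitAt C x) → ∃ (N-CircuitAt C y) → ∃ (N-CircuitAt C z) →
                     ¬ ¬ Conn G C y z
    three-disjoint (Zx , lx@(cx , Zx⊆C , _)) (Zy , ly@(cy , Zy⊆C , _)) (Zz , lz@(cz , Zz⊆C , _)) ¬y⇝z =
      1+n≰n (begin
        3 + rank N C          ≤⟨ N.nullity-mono (∪-⊆ Zx⊆C (∪-⊆ Zy⊆C Zz⊆C)) nullity-3 ⟩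
        ∣ C ∣                 ≡⟨ M.circuit-size circ (proj₁ (proj₂ vx)) ⟩
        suc (rank M C)        ≤⟨ s≤s (rank-≤-suc C) ⟩
        2 + rank N C          ∎)
      where
      open ≤-Reasoning
      Zx#Zy∪Zz : Disjoint Zx (Zy ∪ Zz)
      Zx#Zy∪Zz g∈Zx g∈Zy∪Zz with x∈p∪q⁻ Zy Zz g∈Zy∪Zz
      ... | inj₁ g∈Zy = N-CircuitAt-disjoint ¬x⇝y lx ly g∈Zx g∈Zy
      ... | inj₂ g∈Zz = N-CircuitAt-disjoint ¬x⇝z lx lz g∈Zx g∈Zz
      nullity-3 : N.NullityAtLeast 3 (Zx ∪ (Zy ∪ Zz))
      nullity-3 = N.nullity-∪ Zx#Zy∪Zz (proj₁ cx)
                    (N.nullity-∪ (N-CircuitAt-disjoint ¬y⇝z ly lz) (proj₁ cy) (proj₁ cz))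

  circuit-components : ∀ C → IsCircuit (rank M) C →
    ∃[ a ] ∃[ b ] (∀ v → VertexOf G C v → Conn G C a v ⊎ Conn G C b v)
  circuit-components C circ with M.dependent⇒nonempty (proj₁ circ)
  ... | f , f∈C = at-most-two-classes (VertexOf? C) (Conn? C) (f , f∈C , inj₁ refl)
                                      (no-three-components circ)

  isFramework : IsFramework G (rank M)
  isFramework = component-rank , vertex-closure , circuit-components

theorem1p2 : ∀ {n} (M : Matroid n) → LiftedGraphic M → QuasiGraphic M
theorem1p2 M (M′ , deletion≡M , m , G , graphic) =
  m , G , Framework.isFramework (deletion-elementaryLift M′ M deletion≡M) G graphic
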